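{- Let $A, A' : \mathsf{Set}$ and $A_R : A \to A' \to \mathsf{Prop}$. Let $B : A \to \mathsf{Prop}$, $B' : A' \to \mathsf{Prop}$ and $B_R : \forall (a:A)(a':A'),\ A_R\,a\,a' \to B\,a \to B'\,a' \to \mathsf{Prop}$. Assume (iHrec) for all $a:A$, $a':A'$, $a_R : A_R\,a\,a'$, $\mathrm{IffProps}(B_R\,a\,a'\,a_R)$, and (cHrec) for all $a:A$, $a':A'$, $a_R : A_R\,a\,a'$, $\mathrm{CompleteRel}(B_R\,a\,a'\,a_R)$. Define $R_\Pi : (\forall a:A,\ B\,a) \to (\forall a':A',\ B'\,a') \to \mathsf{Prop}$ by $R_\Pi\,f\,f' := \forall (a:A)(a':A')(a_R : A_R\,a\,a'),\ B_R\,a\,a'\,a_R\,(f\,a)\,(f'\,a')$. Then $\mathrm{Total}(A_R) \to \mathrm{IffProps}(R_\Pi)$, i.e. if $A_R$ is total then $(\forall a:A,\ B\,a) \leftrightarrow (\forall a':A',\ B'\,a')$.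
   Context: Work in Coq's type theory (CIC) with universes $\mathsf{Prop}$ and $\mathsf{Set}$; $\{x : T \,\&\, P\,x\}$ denotes a dependent pair (Σ) type and $\times$ the product type. For $P, Q : \mathsf{Prop}$ and $R : P \to Q \to \mathsf{Prop}$: $\mathrm{IffProps}(R) := (P \leftrightarrow Q)$, $\mathrm{CompleteRel}(R) := \forall (p:P)(q:Q),\ R\,p\,q$. For $X, Y : \mathsf{Set}$ and $R : X \to Y \to \mathsf{Prop}$: $\mathrm{Total}(R) := (\forall x:X,\ \{y : Y \,\&\, R\,x\,y\}) \times (\forall y:Y,\ \{x : X \,\&\, R\,x\,y\})$. -}

module Defs where

open import Data.Product using (Σ; _×_)

-- Coq's Prop and Set are both rendered as Agda's Set.

IffProps : {P Q : Set} → (P → Q → Set) → Set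
IffProps {P} {Q} R = (P → Q) × (Q → P)

CompleteRel : {P Q : Set} → (P → Q → Set) → Set
CompleteRel {P} {Q} R = (p : P) (q : Q) → R p q

Total : {X Y : Set} → (X → Y → Set) → Set
Total {X} {Y} R = ((x : X) → Σ Y (λ y → R x y)) × ((y : Y) → Σ X (λ x → R x y))

RΠ : {A A' : Set} (AR : A → A' → Set) {B : A → Set} {B' : A' → Set}
     (BR : (a : A) (a' : A') → AR a a' → B a → B' a' → Set) →
     ((a : A) → B a) → ((a' : A') → B' a') → Set
RΠ {A} {A'} AR BR f f' = (a : A) (a' : A') (aR : AR a a') → BR a a' aR (f a) (f' a')

-- A function on one side is transported to the other by choosing, for each
-- argument, a related argument via totality of A_R and then converting the
-- value along the fibrewise equivalence B a ↔ B' a'.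
module Submission where

open import Defs
open import Data.Product using (Σ; _,_; proj₁; proj₂)

Π-transport : {A A' : Set} {AR : A → A' → Set} {B : A → Set} {B' : A' → Set} →
              ((a' : A') → Σ A (λ a → AR a a')) →
              ((a : A) (a' : A') → AR a a' → B a → B' a') →
              ((a : A) → B a) → (a' : A') → B' a'
Π-transport surj conv f a' with surj a'
... | a , aR = conv a a' aR (f a)

Π-transport⁻¹ : {A A' : Set} {AR : A → A' → Set} {B : A → Set} {B' : A' → Set} →
                ((a : A) → Σ A' (λ a' → AR a a')) →
                ((a : A) (a' : A') → AR a a' → B' a' → B a) →
                ((a' : A') → B' a') → (a : A) → B a
Π-transport⁻¹ {AR = AR} total conv =
  Π-transport {AR = λ a' a → AR a a'} total (λ a' a aR → conv a a' aR)

lemma4 : (A A' : Set) (AR : A → A' → Set) (B : A → Set) (B' : A' → Set)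
    (BR : (a : A) (a' : A') → AR a a' → B a → B' a' → Set) →
    ((a : A) (a' : A') (aR : AR a a') → IffProps (BR a a' aR)) →
    ((a : A) (a' : A') (aR : AR a a') → CompleteRel (BR a a' aR)) →
    Total AR → IffProps (RΠ AR {B} {B'} BR)
lemma4 A A' AR B B' BR iff _ (total , surj) =
  Π-transport surj (λ a a' aR → proj₁ (iff a a' aR)) ,
  Π-transport⁻¹ total (λ a a' aR → proj₂ (iff a a' aR))
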